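{- The clausal natural deduction calculus $\mathbf{CND}$ simulates the conflict resolution calculus $\mathbf{CR}$: for every $\mathbf{CR}$ derivation of a clause $c$ from a set of clauses $S$ there is a $\mathbf{CND}$ derivation of $c$ from $S$.
   Context: Clauses are finite disjunctions of first-order literals; variables are implicitly universally quantified; $\bar{\ell}$ is the dual of literal $\ell$; $\bot$ is the empty clause with $\Gamma\vee\bot=\Gamma$. All rules work modulo associativity/commutativity of $\vee$, involutivity of negation and neutrality of $\bot$; distinct clauses do not share variables. $\mathbf{CR}$ calculus: derivations are DAGs of clauses whose leaves are clauses of $S$ or decision literals $[\ell]^i$ (arbitrary assumed literals with index $i$), with rules: Unit-propagating resolution $\mathbf{u}(\sigma)$: from unit clauses $\ell_1,\ldots,\ell_n$ and $\bar{\ell'_1}\vee\ldots\vee\bar{\ell'_n}\vee\ell$ infer $\ell\sigma$, $\sigma$ unifying $\ell_k,\ell'_k$ for all $k$; Conflict $\mathbf{c}(\sigma)$: from $\ell$ and $\bar{\ell'}$ infer $\bot$, $\sigma$ unifying $\ell,\ell'$; Conflict-driven clause learning $\mathbf{cl}^i$: from a derivation of $\bot$ using decision literals $[\ell_1]^i,\ldots,[\ell_n]^i$ (and clauses of $S$, previously derived clauses, possibly other undischarged decisions), infer $(\bar{\ell_1}\sigma^1_1\vee\ldots\vee\bar{\ell_1}\sigma^1_{m_1})\vee\ldots\vee(\bar{\ell_n}\sigma^n_1\vee\ldots\vee\bar{\ell_n}\sigma^n_{m_n})$, where $\sigma^k_j$ is the composition of substitutions on the $j$-th path from $\ell_k$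 to $\bot$; these decisions are discharged. $\mathbf{CND}$ calculus (clausal natural deduction): derivations with leaves clauses of $S$ or assumptions $[\ell]^i$, and rules: Implication elimination $\to_E$: from $\ell$ and $\bar{\ell}\vee\Gamma$ infer $\Gamma$; Implication introduction $\to_I^i$: from a derivation of $\Gamma$ using assumption $[\ell]^i$ infer $\bar{\ell}\vee\Gamma$, discharging $[\ell]^i$; Universal elimination $\forall_E$: from $\Gamma$ infer $\Gamma\sigma$ for any substitution $\sigma$; Universal introduction $\forall_I$: from $\Gamma\{x_1\backslash\alpha_1,\ldots,x_n\backslash\alpha_n\}$ infer $\Gamma$, where the $\alpha_k$ are distinct eigenvariables occurring neither in $\Gamma$ nor in any undischarged assumption. -}

module Defs where

open import Data.Nat using (ℕ; _≟_; _≤_)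
open import Data.Bool using (Bool; not)
open import Data.List using (List; []; _∷_; _++_; map; filter; concat; length; concatMap)
open import Data.List.Relation.Unary.All using (All)
open import Data.List.Relation.Unary.Unique.Propositional using (Unique)
open import Data.List.Relation.Binary.Pointwise using (Pointwise)
open import Data.List.Relation.Binary.Permutation.Propositional using (_↭_)
open import Data.List.Membership.Propositional using (_∉_)
open import Data.Product using (_×_; _,_; proj₁; proj₂)
open import Relation.Binary.PropositionalEquality using (_≡_)
open import Relation.Nullary using (¬_; yes; no)
open import Function.Definitions using (Injective)

data Term : Set where
  var : ℕ → Term
  fun : ℕ → List Term → Term

data Literal : Set where
  lit : Bool → ℕ → List Term → Literal

dual : Literal → Literal
dual (lit b p ts) = lit (not b) p ts

-- A clause is a finite disjunction of literals; the empty list is ⊥.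
-- Associativity/commutativity of ∨ and neutrality of ⊥ are handled by
-- working with lists up to permutation (_↭_), see the exchange rules.
Clause : Set
Clause = List Literal

Subst : Set
Subst = ℕ → Term

mutual
  substT : Subst → Term → Term
  substT σ (var x)    = σ x
  substT σ (fun f ts) = fun f (substTs σ ts)

  substTs : Subst → List Term → List Term
  substTs σ []       = []
  substTs σ (t ∷ ts) = substT σ t ∷ substTs σ ts

substL : Subst → Literal → Literal
substL σ (lit b p ts) = lit b p (substTs σ ts)

substC : Subst → Clause → Clause
substC σ = map (substL σ)

mutual
  varsT : Term → List ℕ
  varsT (var x)    = x ∷ []
  varsT (fun f ts) = varsTs ts

  varsTs : List Term → List ℕ
  varsTs []       = []
  varsTs (t ∷ ts) = varsT t ++ varsTs ts

varsL : Literal → List ℕ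
varsL (lit b p ts) = varsTs ts

varsC : Clause → List ℕ
varsC = concatMap varsL

eigen : List (ℕ × ℕ) → Subst
eigen []             y = var y
eigen ((x , α) ∷ xs) y with y ≟ x
... | yes _ = var α
... | no  _ = eigen xs y

Hyp : Set
Hyp = ℕ × Literal

others : ℕ → List Hyp → List Hyp
others i = filter (λ h → ¬? (proj₁ h ≟ i))
  where open import Relation.Nullary.Decidable using (¬?)

withIndex : ℕ → List Hyp → List Hyp
withIndex i = filter (λ h → proj₁ h ≟ i)

substH : Subst → Hyp → Hyp
substH σ (i , ℓ) = i , substL σ ℓ

-- Derivation DAGs are represented by their tree unfoldings; each path
-- from a decision leaf to the root corresponds to one occurrence of the
-- leaf in the tree.  'CR S Δ c' is a derivation of c whose undischarged
-- decision occurrences are listed in Δ, each paired with its literal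
-- already instantiated by the composition of the substitutions on the
-- path from the leaf to the current node.

mutual
  data CR (S : Clause → Set) : List Hyp → Clause → Set where
    -- leaf: a clause of S (variables renamed apart by an injective renaming)
    cr-axiom    : ∀ {c} (ρ : ℕ → ℕ) → Injective _≡_ _≡_ ρ → S c →
                  CR S [] (substC (λ x → var (ρ x)) c)
    cr-decision : ∀ i ℓ → CR S ((i , ℓ) ∷ []) (ℓ ∷ [])
    cr-exchange : ∀ {Δ c c'} → c ↭ c' → CR S Δ c → CR S Δ c'
    cr-u        : ∀ {Δs Δ₀ ls ls' ℓ} (σ : Subst) →
                  1 ≤ length ls →
                  CRUnits S Δs ls →
                  CR S Δ₀ (map dual ls' ++ (ℓ ∷ [])) →
                  Pointwise (λ a b → substL σ a ≡ substL σ b) ls ls' →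
                  CR S (map (substH σ) (Δs ++ Δ₀)) (substL σ ℓ ∷ [])
    cr-c        : ∀ {Δ₁ Δ₂ ℓ ℓ'} (σ : Subst) →
                  CR S Δ₁ (ℓ ∷ []) →
                  CR S Δ₂ (dual ℓ' ∷ []) →
                  substL σ ℓ ≡ substL σ ℓ' →
                  CR S (map (substH σ) (Δ₁ ++ Δ₂)) []
    -- conflict-driven clause learning cl^i: discharges all decisions
    -- with index i, one negated literal per path
    cr-cl       : ∀ {Δ} (i : ℕ) →
                  CR S Δ [] →
                  CR S (others i Δ) (map (λ h → dual (proj₂ h)) (withIndex i Δ))

  data CRUnits (S : Clause → Set) : List Hyp → List Literal → Set where
    []  : CRUnits S [] []
    _∷_ : ∀ {Δ Δs ℓ ls} → CR S Δ (ℓ ∷ []) → CRUnits S Δs ls →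
          CRUnits S (Δ ++ Δs) (ℓ ∷ ls)

data CND (S : Clause → Set) : List Hyp → Clause → Set where
  nd-axiom    : ∀ {c} → S c → CND S [] c
  nd-assume   : ∀ i ℓ → CND S ((i , ℓ) ∷ []) (ℓ ∷ [])
  nd-exchange : ∀ {Δ c c'} → c ↭ c' → CND S Δ c → CND S Δ c'
  nd-impE     : ∀ {Δ₁ Δ₂ ℓ Γ} → CND S Δ₁ (ℓ ∷ []) → CND S Δ₂ (dual ℓ ∷ Γ) →
                CND S (Δ₁ ++ Δ₂) Γ
  nd-impI     : ∀ {Δ Γ} (i : ℕ) (ℓ : Literal) →
                All (λ h → proj₁ h ≡ i → proj₂ h ≡ ℓ) Δ →
                CND S Δ Γ →
                CND S (others i Δ) (dual ℓ ∷ Γ)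
  nd-allE     : ∀ {Δ Γ} (σ : Subst) → CND S Δ Γ → CND S Δ (substC σ Γ)
  nd-allI     : ∀ {Δ Γ} (xs : List (ℕ × ℕ)) →
                Unique (map proj₁ xs) →
                Unique (map proj₂ xs) →
                All (λ α → α ∉ varsC Γ) (map proj₂ xs) →
                All (λ α → All (λ h → α ∉ varsL (proj₂ h)) Δ) (map proj₂ xs) →
                CND S Δ (substC (eigen xs) Γ) →
                CND S Δ Γ

-- A CR derivation of c whose open decisions are Δ becomes a closed CND
-- derivation of the clause ¬Δ ∨ c.  Decisions become tautologies ¬ℓ ∨ ℓ,
-- unifiers become ∀E, learning only permutes the clause, and unit
-- propagation and conflict become resolution steps.  Closed resolution is
-- itself derivable in CND: assume the duals of the side literals under
-- fresh indices, eliminate them with →E down to the resolved unit, apply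
-- →E against the other premise and discharge the assumptions again with →I.
module Submission where

open import Defs
open import Data.Bool.Properties using (not-involutive)
open import Data.Empty using (⊥-elim)
open import Data.List using (List; []; _∷_; _++_; map; filter)
open import Data.List.Properties using (map-++; ++-assoc; ++-identityʳ; filter-all; filter-reject)
open import Data.List.Relation.Unary.All as All using (All; []; _∷_)
open import Data.List.Relation.Binary.Pointwise using (Pointwise; []; _∷_)
open import Data.List.Relation.Binary.Permutation.Propositional
  using (_↭_; ↭-refl; ↭-reflexive; ↭-sym; ↭-trans; prep)
open import Data.List.Relation.Binary.Permutation.Propositional.Properties
  using (shift; ++⁺ˡ; map⁺)
open import Data.Nat using (ℕ; suc; _<_; _≟_)
open import Data.Nat.Properties using (<⇒≢; m<n⇒m<1+n; n<1+n)
open import Data.Product using (_,_; proj₁; proj₂)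
open import Relation.Binary.PropositionalEquality
  using (_≡_; _≢_; ≢-sym; refl; sym; trans; cong; cong₂; subst)
open import Relation.Nullary using (yes; no; ¬?)
open import Relation.Unary using (Pred; Decidable)
open import Relation.Unary.Properties using (∁?)

dual-involutive : ∀ ℓ → dual (dual ℓ) ≡ ℓ
dual-involutive (lit b p ts) = cong (λ b → lit b p ts) (not-involutive b)

substL-dual : ∀ σ ℓ → substL σ (dual ℓ) ≡ dual (substL σ ℓ)
substL-dual σ (lit b p ts) = refl

substC-map-dual : ∀ σ ls → substC σ (map dual ls) ≡ map dual (substC σ ls)
substC-map-dual σ []       = refl
substC-map-dual σ (ℓ ∷ ls) = cong₂ _∷_ (substL-dual σ ℓ) (substC-map-dual σ ls)

↭-filter-complement : ∀ {a p} {A : Set a} {P : Pred A p} (P? : Decidable P) xs →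
                      xs ↭ filter (∁? P?) xs ++ filter P? xs
↭-filter-complement P? []       = ↭-refl
↭-filter-complement P? (x ∷ xs) with P? x
... | yes _ = ↭-trans (prep x (↭-filter-complement P? xs))
                      (↭-sym (shift x (filter (∁? P?) xs) (filter P? xs)))
... | no  _ = prep x (↭-filter-complement P? xs)

negated : List Hyp → Clause
negated = map (λ h → dual (proj₂ h))

infixr 5 _⇒_

_⇒_ : List Hyp → Clause → Clause
Δ ⇒ c = negated Δ ++ c

negated-++ : ∀ Δ₁ Δ₂ → negated (Δ₁ ++ Δ₂) ≡ negated Δ₁ ++ negated Δ₂
negated-++ = map-++ _

⇒-++ : ∀ Δ₁ Δ₂ c → (Δ₁ ++ Δ₂) ⇒ c ≡ negated Δ₁ ++ Δ₂ ⇒ c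
⇒-++ Δ₁ Δ₂ c = trans (cong (_++ c) (negated-++ Δ₁ Δ₂)) (++-assoc (negated Δ₁) (negated Δ₂) c)

substC-negated : ∀ σ Δ → substC σ (negated Δ) ≡ negated (map (substH σ) Δ)
substC-negated σ []            = refl
substC-negated σ ((i , ℓ) ∷ Δ) = cong₂ _∷_ (substL-dual σ ℓ) (substC-negated σ Δ)

substC-⇒ : ∀ σ Δ c → substC σ (Δ ⇒ c) ≡ map (substH σ) Δ ⇒ substC σ c
substC-⇒ σ Δ c = trans (map-++ (substL σ) (negated Δ) c) (cong (_++ _) (substC-negated σ Δ))

negated-split : ∀ i Δ → negated Δ ↭ negated (others i Δ) ++ negated (withIndex i Δ)
negated-split i Δ = ↭-trans (map⁺ _ (↭-filter-complement (λ h → proj₁ h ≟ i) Δ))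
                            (↭-reflexive (negated-++ (others i Δ) (withIndex i Δ)))

others-head : ∀ {i ℓ} {Δ : List Hyp} → All (λ h → proj₁ h ≢ i) Δ →
              others i ((i , ℓ) ∷ Δ) ≡ Δ
others-head {i} {ℓ} {Δ} fresh =
  trans (filter-reject P? {x = i , ℓ} {xs = Δ} (λ ≢i → ≢i refl)) (filter-all P? fresh)
  where P? = λ (h : Hyp) → ¬? (proj₁ h ≟ i)

dualHyps : ℕ → Clause → List Hyp
dualHyps n []      = []
dualHyps n (d ∷ D) = (n , dual d) ∷ dualHyps (suc n) D

dualHyps-fresh : ∀ {n m} D → n < m → All (λ h → proj₁ h ≢ n) (dualHyps m D)
dualHyps-fresh []      n<m = []
dualHyps-fresh (d ∷ D) n<m = ≢-sym (<⇒≢ n<m) ∷ dualHyps-fresh D (m<n⇒m<1+n n<m)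

module _ {S : Clause → Set} where

  nd-cast : ∀ {Δ Γ Γ'} → Γ ≡ Γ' → CND S Δ Γ → CND S Δ Γ'
  nd-cast = subst (CND S _)

  nd-impI-head : ∀ {i ℓ Δ Γ} → All (λ h → proj₁ h ≢ i) Δ →
                 CND S ((i , ℓ) ∷ Δ) Γ → CND S Δ (dual ℓ ∷ Γ)
  nd-impI-head {i} {ℓ} fresh d =
    subst (λ Δ → CND S Δ _) (others-head fresh)
          (nd-impI i ℓ ((λ _ → refl) ∷ All.map (λ ≢i ≡i → ⊥-elim (≢i ≡i)) fresh) d)

  nd-assumeDuals : ∀ n D {Γ} → CND S [] (D ++ Γ) → CND S (dualHyps n D) Γ
  nd-assumeDuals n []      d = d
  nd-assumeDuals n (x ∷ D) d =
    nd-impE (nd-assume n (dual x))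
            (nd-cast (cong (_∷ _) (sym (dual-involutive x)))
                     (nd-assumeDuals (suc n) D (nd-exchange (↭-sym (shift x D _)) d)))

  nd-dischargeDuals : ∀ n D {Γ} → CND S (dualHyps n D) Γ → CND S [] (D ++ Γ)
  nd-dischargeDuals n []      d = d
  nd-dischargeDuals n (x ∷ D) d =
    nd-exchange (shift x D _)
      (nd-dischargeDuals (suc n) D
        (nd-cast (cong (_∷ _) (dual-involutive x))
                 (nd-impI-head (dualHyps-fresh D (n<1+n n)) d)))

  nd-resolve : ∀ {D ℓ E} → CND S [] (D ++ ℓ ∷ []) → CND S [] (dual ℓ ∷ E) → CND S [] (D ++ E)
  nd-resolve {D} d e =
    nd-dischargeDuals 0 D
      (subst (λ Δ → CND S Δ _) (++-identityʳ _) (nd-impE (nd-assumeDuals 0 D d) e))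

  ⇒-instantiate : ∀ σ {Δ c} → CND S [] (Δ ⇒ c) → CND S [] (map (substH σ) Δ ⇒ substC σ c)
  ⇒-instantiate σ {Δ} {c} d = nd-cast (substC-⇒ σ Δ c) (nd-allE σ d)

  ⇒-resolve : ∀ {Δ₁ Δ₂ ℓ E} → CND S [] (Δ₁ ⇒ ℓ ∷ []) → CND S [] (Δ₂ ⇒ dual ℓ ∷ E) →
              CND S [] ((Δ₁ ++ Δ₂) ⇒ E)
  ⇒-resolve {Δ₁} {Δ₂} {ℓ} {E} d e =
    nd-cast (sym (⇒-++ Δ₁ Δ₂ E)) (nd-resolve d (nd-exchange (shift (dual ℓ) (negated Δ₂) E) e))

  ⇒-decide : ∀ i ℓ → CND S [] (((i , ℓ) ∷ []) ⇒ ℓ ∷ [])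
  ⇒-decide i ℓ = nd-impI-head [] (nd-assume i ℓ)

  ⇒-learn : ∀ i {Δ} → CND S [] (Δ ⇒ []) → CND S [] (others i Δ ⇒ negated (withIndex i Δ))
  ⇒-learn i {Δ} = nd-exchange (↭-trans (↭-reflexive (++-identityʳ _)) (negated-split i Δ))

  ⇒-cast-hyps : ∀ {Δ Δ' c} → Δ ≡ Δ' → CND S [] (Δ ⇒ c) → CND S [] (Δ' ⇒ c)
  ⇒-cast-hyps {c = c} eq = nd-cast (cong (_⇒ c) eq)

  mutual
    cr⇒cnd : ∀ {Δ c} → CR S Δ c → CND S [] (Δ ⇒ c)
    cr⇒cnd (cr-axiom ρ _ s)      = nd-allE (λ x → var (ρ x)) (nd-axiom s)
    cr⇒cnd (cr-decision i ℓ)     = ⇒-decide i ℓ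
    cr⇒cnd {Δ} (cr-exchange p d) = nd-exchange (++⁺ˡ (negated Δ) p) (cr⇒cnd d)
    cr⇒cnd (cr-u {Δs} {Δ₀} {ls' = ls'} {ℓ} σ _ us d eqs) =
      ⇒-cast-hyps (sym (map-++ (substH σ) Δs Δ₀))
        (units-resolve σ us eqs
          (nd-cast (cong (map (substH σ) Δ₀ ⇒_)
                         (trans (map-++ (substL σ) (map dual ls') (ℓ ∷ []))
                                (cong (_++ _) (substC-map-dual σ ls'))))
                   (⇒-instantiate σ {Δ₀} (cr⇒cnd d))))
    cr⇒cnd (cr-c {Δ₁} {Δ₂} {ℓ} {ℓ'} σ d₁ d₂ eq) =
      ⇒-cast-hyps (sym (map-++ (substH σ) Δ₁ Δ₂))
        (⇒-resolve {map (substH σ) Δ₁} {map (substH σ) Δ₂}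
                   (⇒-instantiate σ {Δ₁} (cr⇒cnd d₁))
                   (nd-cast (cong (λ x → map (substH σ) Δ₂ ⇒ x ∷ [])
                                  (trans (substL-dual σ ℓ') (cong dual (sym eq))))
                            (⇒-instantiate σ {Δ₂} (cr⇒cnd d₂))))
    cr⇒cnd (cr-cl i d)           = ⇒-learn i (cr⇒cnd d)

    -- The units are resolved last to first, so that their decisions come out
    -- in the order in which CR lists them.
    units-resolve : ∀ σ {Δs ls ls' Δ₀ Y} → CRUnits S Δs ls →
                    Pointwise (λ a b → substL σ a ≡ substL σ b) ls ls' →
                    CND S [] (Δ₀ ⇒ map dual (substC σ ls') ++ Y) →
                    CND S [] ((map (substH σ) Δs ++ Δ₀) ⇒ Y)
    units-resolve σ [] [] d = d
    units-resolve σ {Δ₀ = Δ₀} {Y} (_∷_ {Δ} {Δs} u us) (_∷_ {ys = ls'} eq eqs) d =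
      ⇒-cast-hyps (sym (trans (cong (_++ Δ₀) (map-++ (substH σ) Δ Δs))
                              (++-assoc (map (substH σ) Δ) (map (substH σ) Δs) Δ₀)))
        (⇒-resolve {map (substH σ) Δ} {map (substH σ) Δs ++ Δ₀}
                   (⇒-instantiate σ {Δ} (cr⇒cnd u))
                   (nd-cast (cong (λ x → (map (substH σ) Δs ++ Δ₀) ⇒ dual x ∷ Y) (sym eq))
                            (units-resolve σ us eqs
                              (nd-exchange (++⁺ˡ (negated Δ₀)
                                             (↭-sym (shift _ (map dual (substC σ ls')) Y))) d))))

theorem2 : (S : Clause → Set) (c : Clause) → CR S [] c → CND S [] c
theorem2 S c = cr⇒cnd
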